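{- For the Petersen graph $\mathcal{P}$, $\mathrm{edim}_f(\mathcal{P})=\frac{5}{2}$.
   Context: All graphs are finite, simple, undirected; $d(u,w)$ is the length of a shortest $u$–$w$ path. For a vertex $v$ and an edge $e=xy$, $d(e,v)=\min\{d(x,v),d(y,v)\}$; for distinct edges $e_1,e_2$, $R_e\{e_1,e_2\}=\{v: d(v,e_1)\neq d(v,e_2)\}$. For $g:V\to\mathbb{R}$ and $U\subseteq V$, $g(U)=\sum_{s\in U}g(s)$. A function $g:V(G)\to[0,1]$ is an edge resolving function of $G$ if $g(R_e\{e_1,e_2\})\ge1$ for all distinct edges $e_1,e_2$, and $\mathrm{edim}_f(G)=\min\{g(V(G)): g\text{ an edge resolving function of }G\}$.
   Formalization: The edge resolving functions g take rational values in [0,1] rather than real values. -}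

module Defs where

open import Data.Nat as ℕ using (ℕ; zero; suc)
open import Data.Fin as Fin using (Fin; toℕ)
open import Data.Bool using (Bool; true; false; _∧_; _∨_; if_then_else_)
open import Data.List using (List; []; _∷_; allFin; foldr)
open import Data.Bool.ListAction using (any)
open import Data.Product using (Σ; _×_; _,_)
open import Data.Rational as ℚ using (ℚ; 0ℚ; 1ℚ; _≤_; _+_)
open import Relation.Binary.PropositionalEquality using (_≡_; _≢_)
open import Relation.Nullary using (¬_; does)

record Graph : Set where
  field
    n     : ℕ
    adj   : Fin n → Fin n → Bool
    sym   : ∀ u v → adj u v ≡ adj v u
    irref : ∀ u → adj u u ≡ false

open Graph public

module _ (G : Graph) where
  private
    N = n G
    V = Fin N

  reach : ℕ → V → V → Bool
  reach zero    u w = does (u Fin.≟ w)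
  reach (suc k) u w = reach k u w ∨ any (λ v → adj G u v ∧ reach k v w) (allFin N)

  -- least k < fuel with reach k u w (fuel exhausted ⇒ returns the start + fuel)
  private
    search : ℕ → ℕ → V → V → ℕ
    search k zero       u w = k
    search k (suc fuel) u w = if reach k u w then k else search (suc k) fuel u w

  -- d(u,w): length of a shortest u–w path (a shortest walk is a path, and
  -- in a connected graph on N vertices it has length < N).
  dist : V → V → ℕ
  dist u w = search 0 N u w

  record Edge : Set where
    constructor edge
    field
      x   : V
      y   : V
      x<y : toℕ x ℕ.< toℕ y
      xy  : adj G x y ≡ true

  edist : Edge → V → ℕ
  edist e v = ℕ._⊓_ (dist (Edge.x e) v) (dist (Edge.y e) v)

  DistinctEdges : Edge → Edge → Set
  DistinctEdges e₁ e₂ = ¬ (Edge.x e₁ ≡ Edge.x e₂ × Edge.y e₁ ≡ Edge.y e₂)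

  weightOfResolving : (V → ℚ) → Edge → Edge → ℚ
  weightOfResolving g e₁ e₂ =
    foldr (λ v s → (if does (edist e₁ v ℕ.≟ edist e₂ v) then 0ℚ else g v) + s)
          0ℚ (allFin N)

  total : (V → ℚ) → ℚ
  total g = foldr (λ v s → g v + s) 0ℚ (allFin N)

  IsEdgeResolvingFunction : (V → ℚ) → Set
  IsEdgeResolvingFunction g =
    (∀ v → 0ℚ ≤ g v × g v ≤ 1ℚ) ×
    (∀ e₁ e₂ → DistinctEdges e₁ e₂ → 1ℚ ≤ weightOfResolving g e₁ e₂)

  FracEdgeMetricDimIs : ℚ → Set
  FracEdgeMetricDimIs r =
    (Σ (V → ℚ) λ g → IsEdgeResolvingFunction g × total g ≡ r) ×
    (∀ g → IsEdgeResolvingFunction g → r ≤ total g)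

-- The Petersen graph: outer 5-cycle 0..4 (i ~ i+1 mod 5), spokes i ~ i+5,
-- inner pentagram 5..9 (5+i ~ 5+(i+2 mod 5)).

petersenEdges : List (ℕ × ℕ)
petersenEdges =
  (0 , 1) ∷ (1 , 2) ∷ (2 , 3) ∷ (3 , 4) ∷ (4 , 0) ∷
  (0 , 5) ∷ (1 , 6) ∷ (2 , 7) ∷ (3 , 8) ∷ (4 , 9) ∷
  (5 , 7) ∷ (7 , 9) ∷ (9 , 6) ∷ (6 , 8) ∷ (8 , 5) ∷ []

petersenAdj : Fin 10 → Fin 10 → Bool
petersenAdj u v = any match petersenEdges
  where
    eqℕ : ℕ → ℕ → Bool
    eqℕ a b = does (a ℕ.≟ b)
    match : ℕ × ℕ → Bool
    match (a , b) = (eqℕ (toℕ u) a ∧ eqℕ (toℕ v) b) ∨ (eqℕ (toℕ u) b ∧ eqℕ (toℕ v) a)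

Petersen : Graph
Petersen = record
  { n = 10
  ; adj = petersenAdj
  ; sym = symP
  ; irref = irrP
  }
  where
    open import Data.Fin.Patterns
    open import Relation.Binary.PropositionalEquality using (refl)
    irrP : ∀ u → petersenAdj u u ≡ false
    irrP 0F = refl
    irrP 1F = refl
    irrP 2F = refl
    irrP 3F = refl
    irrP 4F = refl
    irrP 5F = refl
    irrP 6F = refl
    irrP 7F = refl
    irrP 8F = refl
    irrP 9F = refl
    symP : ∀ u v → petersenAdj u v ≡ petersenAdj v u
    symP 0F 0F = refl
    symP 0F 1F = refl
    symP 0F 2F = refl
    symP 0F 3F = refl
    symP 0F 4F = refl
    symP 0F 5F = refl
    symP 0F 6F = refl
    symP 0F 7F = refl
    symP 0F 8F = refl
    symP 0F 9F = refl
    symP 1F 0F = refl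
    symP 1F 1F = refl
    symP 1F 2F = refl
    symP 1F 3F = refl
    symP 1F 4F = refl
    symP 1F 5F = refl
    symP 1F 6F = refl
    symP 1F 7F = refl
    symP 1F 8F = refl
    symP 1F 9F = refl
    symP 2F 0F = refl
    symP 2F 1F = refl
    symP 2F 2F = refl
    symP 2F 3F = refl
    symP 2F 4F = refl
    symP 2F 5F = refl
    symP 2F 6F = refl
    symP 2F 7F = refl
    symP 2F 8F = refl
    symP 2F 9F = refl
    symP 3F 0F = refl
    symP 3F 1F = refl
    symP 3F 2F = refl
    symP 3F 3F = refl
    symP 3F 4F = refl
    symP 3F 5F = refl
    symP 3F 6F = refl
    symP 3F 7F = refl
    symP 3F 8F = refl
    symP 3F 9F = refl
    symP 4F 0F = refl
    symP 4F 1F = refl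
    symP 4F 2F = refl
    symP 4F 3F = refl
    symP 4F 4F = refl
    symP 4F 5F = refl
    symP 4F 6F = refl
    symP 4F 7F = refl
    symP 4F 8F = refl
    symP 4F 9F = refl
    symP 5F 0F = refl
    symP 5F 1F = refl
    symP 5F 2F = refl
    symP 5F 3F = refl
    symP 5F 4F = refl
    symP 5F 5F = refl
    symP 5F 6F = refl
    symP 5F 7F = refl
    symP 5F 8F = refl
    symP 5F 9F = refl
    symP 6F 0F = refl
    symP 6F 1F = refl
    symP 6F 2F = refl
    symP 6F 3F = refl
    symP 6F 4F = refl
    symP 6F 5F = refl
    symP 6F 6F = refl
    symP 6F 7F = refl
    symP 6F 8F = refl
    symP 6F 9F = refl
    symP 7F 0F = refl
    symP 7F 1F = refl
    symP 7F 2F = refl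
    symP 7F 3F = refl
    symP 7F 4F = refl
    symP 7F 5F = refl
    symP 7F 6F = refl
    symP 7F 7F = refl
    symP 7F 8F = refl
    symP 7F 9F = refl
    symP 8F 0F = refl
    symP 8F 1F = refl
    symP 8F 2F = refl
    symP 8F 3F = refl
    symP 8F 4F = refl
    symP 8F 5F = refl
    symP 8F 6F = refl
    symP 8F 7F = refl
    symP 8F 8F = refl
    symP 8F 9F = refl
    symP 9F 0F = refl
    symP 9F 1F = refl
    symP 9F 2F = refl
    symP 9F 3F = refl
    symP 9F 4F = refl
    symP 9F 5F = refl
    symP 9F 6F = refl
    symP 9F 7F = refl
    symP 9F 8F = refl
    symP 9F 9F = refl

-- Every two distinct edges of the Petersen graph are resolved by at least four vertices, so the
-- constant function 1/4 is edge resolving, of total weight 10/4. Conversely, each of the 15 pairs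
-- of edges at distance 2 is resolved exactly by its four endpoints, and every vertex lies in 6 of
-- these 15 sets; summing the 15 constraints g(R) ≥ 1 gives 6 g(V) ≥ 15.

module Submission where

open import Defs hiding (sym)
open import Data.Integer using (+_)
open import Data.Rational using (_/_)

open import Algebra.Bundles using (Ring)
open import Data.Bool as Bool using (false; true; if_then_else_)
open import Data.Fin as Fin using (Fin; zero; suc)
open import Data.Fin.Patterns
open import Data.Fin.Properties using (all?)
open import Data.List as List using (allFin)
open import Data.Nat as ℕ using (ℕ; _⊓_)
open import Data.Product using (_×_; _,_; proj₁; proj₂; uncurry)
open import Data.Rational as ℚ using (ℚ; 0ℚ; 1ℚ; _≤_; _+_; _*_)
open import Data.Rational.Properties as ℚ using (+-*-ring; +-mono-≤; *-monoʳ-≤-nonNeg; *-cancelˡ-≤-pos)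
open import Data.Unit using (tt)
open import Data.Vec as Vec using (_∷_; [])
open import Data.Vec.Functional as Vector using (Vector)
open import Function using (id; const; _∘_)
open import Relation.Binary.PropositionalEquality using (_≡_; refl; sym; trans; cong; cong₂; subst; module ≡-Reasoning)
open import Relation.Nullary using (Dec; does; ¬_; ¬?)
open import Relation.Nullary.Decidable using (True; toWitness; _×-dec_; _→-dec_)

open import Algebra.Properties.Semiring.Sum (Ring.semiring +-*-ring)
  using (sum; sum-syntax; sum-cong-≗; ∑-comm; *-distribˡ-sum; *-distribʳ-sum)

foldr-tabulate : ∀ {a b c} {A : Set a} {B : Set b} {C : Set c} {n}
                 (f : Fin n → A) (h : A → B) (_∙_ : B → C → C) (z : C) →
                 List.foldr (λ v s → h v ∙ s) z (List.tabulate f) ≡ Vector.foldr _∙_ z (h ∘ f)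
foldr-tabulate {n = ℕ.zero}  f h _∙_ z = refl
foldr-tabulate {n = ℕ.suc n} f h _∙_ z = cong (h (f zero) ∙_) (foldr-tabulate (f ∘ suc) h _∙_ z)

foldr-allFin≡∑ : ∀ {n} (f : Fin n → ℚ) → List.foldr (λ v s → f v + s) 0ℚ (allFin n) ≡ ∑[ v < n ] f v
foldr-allFin≡∑ f = foldr-tabulate id f _+_ 0ℚ

sum-mono-≤ : ∀ {k} {f h : Vector ℚ k} → (∀ i → f i ≤ h i) → sum f ≤ sum h
sum-mono-≤ {ℕ.zero}  f≤h = ℚ.≤-refl
sum-mono-≤ {ℕ.suc k} f≤h = +-mono-≤ (f≤h zero) (sum-mono-≤ (f≤h ∘ suc))

module _ (G : Graph) where
  private
    V = Fin (n G)

  endpoints : Edge G → V × V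
  endpoints e = Edge.x e , Edge.y e

  distinctEdges? : ∀ e₁ e₂ → Dec (DistinctEdges G e₁ e₂)
  distinctEdges? e₁ e₂ = ¬? (Edge.x e₁ Fin.≟ Edge.x e₂ ×-dec Edge.y e₁ Fin.≟ Edge.y e₂)

  resolves : Edge G → Edge G → V → ℚ
  resolves e₁ e₂ v = if does (edist G e₁ v ℕ.≟ edist G e₂ v) then 0ℚ else 1ℚ

  resolvingSetSize : Edge G → Edge G → ℚ
  resolvingSetSize e₁ e₂ = ∑[ v < n G ] resolves e₁ e₂ v

  total≡∑ : ∀ g → total G g ≡ ∑[ v < n G ] g v
  total≡∑ = foldr-allFin≡∑

  weightOfResolving≡∑ : ∀ g e₁ e₂ → weightOfResolving G g e₁ e₂ ≡ ∑[ v < n G ] (resolves e₁ e₂ v * g v)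
  weightOfResolving≡∑ g e₁ e₂ = begin
    weightOfResolving G g e₁ e₂                                             ≡⟨ foldr-allFin≡∑ {n G} _ ⟩
    ∑[ v < n G ] (if does (edist G e₁ v ℕ.≟ edist G e₂ v) then 0ℚ else g v) ≡⟨ sum-cong-≗ asProduct ⟩
    ∑[ v < n G ] (resolves e₁ e₂ v * g v)                                   ∎
    where
      open ≡-Reasoning
      asProduct : ∀ v → (if does (edist G e₁ v ℕ.≟ edist G e₂ v) then 0ℚ else g v) ≡ resolves e₁ e₂ v * g v
      asProduct v with does (edist G e₁ v ℕ.≟ edist G e₂ v)
      ... | true  = sym (ℚ.*-zeroˡ (g v))
      ... | false = sym (ℚ.*-identityˡ (g v))

  weightOfResolving-const : ∀ c e₁ e₂ → weightOfResolving G (const c) e₁ e₂ ≡ resolvingSetSize e₁ e₂ * c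
  weightOfResolving-const c e₁ e₂ = trans
    (weightOfResolving≡∑ (const c) e₁ e₂) (sym (*-distribʳ-sum c (resolves e₁ e₂)))

  const-isEdgeResolving : ∀ {k c} → 0ℚ ≤ c → c ≤ 1ℚ → 1ℚ ≤ k * c →
                          (∀ e₁ e₂ → DistinctEdges G e₁ e₂ → k ≤ resolvingSetSize e₁ e₂) →
                          IsEdgeResolvingFunction G (const c)
  const-isEdgeResolving {k} {c} 0≤c c≤1 1≤kc k≤∣R∣ = (λ _ → 0≤c , c≤1) , resolving
    where
      open ℚ.≤-Reasoning
      resolving : ∀ e₁ e₂ → DistinctEdges G e₁ e₂ → 1ℚ ≤ weightOfResolving G (const c) e₁ e₂
      resolving e₁ e₂ e₁≢e₂ = begin
        1ℚ                                 ≤⟨ 1≤kc ⟩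
        k * c                              ≤⟨ *-monoʳ-≤-nonNeg c {{ℚ.nonNegative 0≤c}} (k≤∣R∣ e₁ e₂ e₁≢e₂) ⟩
        resolvingSetSize e₁ e₂ * c         ≡⟨ sym (weightOfResolving-const c e₁ e₂) ⟩
        weightOfResolving G (const c) e₁ e₂ ∎

  total-lowerBound : ∀ {k} (e₁ e₂ : Fin k → Edge G) → (∀ i → DistinctEdges G (e₁ i) (e₂ i)) →
                     ∀ {m} → (∀ v → ∑[ i < k ] resolves (e₁ i) (e₂ i) v ≡ m) →
                     ∀ {g} → IsEdgeResolvingFunction G g → ∑[ i < k ] 1ℚ ≤ m * total G g
  total-lowerBound {k} e₁ e₂ distinct {m} cover {g} (_ , resolving) = begin
    ∑[ i < k ] 1ℚ                                  ≤⟨ sum-mono-≤ {k} (λ i → resolving (e₁ i) (e₂ i) (distinct i)) ⟩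
    ∑[ i < k ] weightOfResolving G g (e₁ i) (e₂ i) ≡⟨ sum-cong-≗ {k} (λ i → weightOfResolving≡∑ g (e₁ i) (e₂ i)) ⟩
    ∑[ i < k ] ∑[ v < n G ] (R i v * g v)          ≡⟨ ∑-comm (λ i v → R i v * g v) ⟩
    ∑[ v < n G ] ∑[ i < k ] (R i v * g v)          ≡⟨ sum-cong-≗ {n G} (λ v → sym (*-distribʳ-sum (g v) (λ i → R i v))) ⟩
    ∑[ v < n G ] ((∑[ i < k ] R i v) * g v)        ≡⟨ sum-cong-≗ {n G} (λ v → cong (_* g v) (cover v)) ⟩
    ∑[ v < n G ] (m * g v)                         ≡⟨ sym (*-distribˡ-sum m g) ⟩
    m * ∑[ v < n G ] g v                           ≡⟨ cong (m *_) (sym (total≡∑ g)) ⟩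
    m * total G g                                  ∎
    where
      open ℚ.≤-Reasoning
      R : Fin k → V → ℚ
      R i = resolves (e₁ i) (e₂ i)

petersenDist : Fin 10 → Fin 10 → ℕ
petersenDist u w = if does (u Fin.≟ w) then 0 else if petersenAdj u w then 1 else 2

dist-Petersen : ∀ u w → dist Petersen u w ≡ petersenDist u w
dist-Petersen = toWitness {a? = all? λ u → all? λ w → dist Petersen u w ℕ.≟ petersenDist u w} tt

-- `resolves Petersen` with the distances tabulated: normalising `dist` itself would make the
-- exhaustive checks below far too slow.
resolvesᴾ : Fin 10 × Fin 10 → Fin 10 × Fin 10 → Fin 10 → ℚ
resolvesᴾ (a , b) (c , d) v =
  if does (petersenDist a v ⊓ petersenDist b v ℕ.≟ petersenDist c v ⊓ petersenDist d v) then 0ℚ else 1ℚ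

resolves-Petersen : ∀ e₁ e₂ v → resolves Petersen e₁ e₂ v ≡ resolvesᴾ (endpoints Petersen e₁) (endpoints Petersen e₂) v
resolves-Petersen e₁ e₂ v = cong₂ (λ s t → if does (s ℕ.≟ t) then 0ℚ else 1ℚ) (edist-Petersen e₁) (edist-Petersen e₂)
  where
    edist-Petersen : ∀ e → edist Petersen e v ≡ petersenDist (Edge.x e) v ⊓ petersenDist (Edge.y e) v
    edist-Petersen e = cong₂ _⊓_ (dist-Petersen (Edge.x e) v) (dist-Petersen (Edge.y e) v)

resolvingSetSize-Petersen : ∀ e₁ e₂ → DistinctEdges Petersen e₁ e₂ → + 4 / 1 ≤ resolvingSetSize Petersen e₁ e₂
resolvingSetSize-Petersen e₁@(edge a b a<b ab) e₂@(edge c d c<d cd) e₁≢e₂ =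
  subst (+ 4 / 1 ≤_) (sum-cong-≗ (λ v → sym (resolves-Petersen e₁ e₂ v))) (byExhaustion a b c d a<b ab c<d cd e₁≢e₂)
  where
    byExhaustion : ∀ a b c d → a Fin.< b → petersenAdj a b ≡ true → c Fin.< d → petersenAdj c d ≡ true →
                   ¬ (a ≡ c × b ≡ d) → + 4 / 1 ≤ ∑[ v < 10 ] resolvesᴾ (a , b) (c , d) v
    byExhaustion = toWitness {a? = all? λ a → all? λ b → all? λ c → all? λ d →
      a Fin.<? b →-dec petersenAdj a b Bool.≟ true →-dec c Fin.<? d →-dec petersenAdj c d Bool.≟ true →-dec
      ¬? (a Fin.≟ c ×-dec b Fin.≟ d) →-dec + 4 / 1 ℚ.≤? ∑[ v < 10 ] resolvesᴾ (a , b) (c , d) v} tt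

edgeᴾ : (a b : Fin 10) → {True (a Fin.<? b)} → {True (petersenAdj a b Bool.≟ true)} → Edge Petersen
edgeᴾ a b {a<b} {ab} = edge a b (toWitness a<b) (toWitness ab)

-- The pairs of edges at distance 2; every edge lies in two of them and every vertex on three edges.
farPairs : Fin 15 → Edge Petersen × Edge Petersen
farPairs = Vec.lookup
  ( (edgeᴾ 0F 1F , edgeᴾ 3F 8F) ∷ (edgeᴾ 0F 1F , edgeᴾ 7F 9F) ∷ (edgeᴾ 1F 2F , edgeᴾ 4F 9F)
  ∷ (edgeᴾ 1F 2F , edgeᴾ 5F 8F) ∷ (edgeᴾ 2F 3F , edgeᴾ 0F 5F) ∷ (edgeᴾ 2F 3F , edgeᴾ 6F 9F)
  ∷ (edgeᴾ 3F 4F , edgeᴾ 1F 6F) ∷ (edgeᴾ 3F 4F , edgeᴾ 5F 7F) ∷ (edgeᴾ 0F 4F , edgeᴾ 2F 7F)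
  ∷ (edgeᴾ 0F 4F , edgeᴾ 6F 8F) ∷ (edgeᴾ 0F 5F , edgeᴾ 6F 9F) ∷ (edgeᴾ 1F 6F , edgeᴾ 5F 7F)
  ∷ (edgeᴾ 2F 7F , edgeᴾ 6F 8F) ∷ (edgeᴾ 3F 8F , edgeᴾ 7F 9F) ∷ (edgeᴾ 4F 9F , edgeᴾ 5F 8F) ∷ [])

farPairs-distinct : ∀ i → uncurry (DistinctEdges Petersen) (farPairs i)
farPairs-distinct = toWitness {a? = all? λ i → uncurry (distinctEdges? Petersen) (farPairs i)} tt

farPairs-cover : ∀ v → ∑[ i < 15 ] uncurry (resolves Petersen) (farPairs i) v ≡ + 6 / 1
farPairs-cover v = trans (sum-cong-≗ (λ i → resolves-Petersen (first i) (second i) v)) (byExhaustion v)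
  where
    first second : Fin 15 → Edge Petersen
    first = proj₁ ∘ farPairs
    second = proj₂ ∘ farPairs
    byExhaustion : ∀ v → ∑[ i < 15 ] resolvesᴾ (endpoints Petersen (first i)) (endpoints Petersen (second i)) v ≡ + 6 / 1
    byExhaustion = toWitness {a? = all? λ v →
      ∑[ i < 15 ] resolvesᴾ (endpoints Petersen (first i)) (endpoints Petersen (second i)) v ℚ.≟ + 6 / 1} tt

mainTheorem12 : FracEdgeMetricDimIs Petersen ((+ 5) / 2)
mainTheorem12 = (const ¼ , ¼-isEdgeResolving , refl) , 5/2≤total
  where
    ¼ : ℚ
    ¼ = + 1 / 4
    ¼-isEdgeResolving : IsEdgeResolvingFunction Petersen (const ¼)
    ¼-isEdgeResolving = const-isEdgeResolving Petersen (ℚ.≤ᵇ⇒≤ tt) (ℚ.≤ᵇ⇒≤ tt) ℚ.≤-refl resolvingSetSize-Petersen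
    5/2≤total : ∀ g → IsEdgeResolvingFunction Petersen g → (+ 5) / 2 ≤ total Petersen g
    -- both `∑[ i < 15 ] 1ℚ` and `6 * (5/2)` normalise to 15
    5/2≤total g isERF = *-cancelˡ-≤-pos (+ 6 / 1)
      (total-lowerBound Petersen (proj₁ ∘ farPairs) (proj₂ ∘ farPairs) farPairs-distinct farPairs-cover isERF)
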